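{- For every integer $n\geq 7$ there exist trees $T_1$ and $T_2$, each on $n$ vertices, such that $\psi(T_1)=\psi(T_2)$ but $T_1$ and $T_2$ are not isomorphic.
   Context: All graphs are finite and simple. For a graph $G=(V,E)$ and a positive integer $k$, a $k$-path vertex cover of $G$ is a set $S\subseteq V$ such that every path on $k$ vertices in $G$ contains at least one vertex of $S$, and $\psi_k(G)$ is the minimum cardinality of such a set. For a graph $G$ on $n$ vertices, its path sequence is $\psi(G)=(\psi_1(G),\psi_2(G),\ldots,\psi_n(G))$. -}

module Defs where

open import Data.Nat using (ℕ; zero; suc; _≤_; _<_)
open import Data.Fin using (Fin; zero; suc; inject₁; fromℕ)
open import Data.Fin.Subset using (Subset; _∈_; ∣_∣)
open import Data.Bool using (Bool; true; false)
open import Data.Product using (Σ; ∃; _×_; _,_)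
open import Relation.Binary.PropositionalEquality using (_≡_)
open import Relation.Nullary using (¬_)
open import Function.Definitions using (Injective)
open import Function.Bundles using (_↔_; Inverse)

record Graph (n : ℕ) : Set where
  field
    adj    : Fin n → Fin n → Bool
    adj-sym    : ∀ u v → adj u v ≡ adj v u
    adj-irrefl : ∀ v → adj v v ≡ false

open Graph public

Adjacent : ∀ {n} → Graph n → Fin n → Fin n → Set
Adjacent G u v = adj G u v ≡ true

-- p : Fin (suc m) → Fin n is a path on (suc m) vertices:
-- pairwise distinct vertices, consecutive ones adjacent.
IsPath : ∀ {n} → Graph n → (m : ℕ) → (Fin (suc m) → Fin n) → Set
IsPath G m p = Injective _≡_ _≡_ p × (∀ (i : Fin m) → Adjacent G (p (inject₁ i)) (p (suc i)))

IsCycle : ∀ {n} → Graph n → (m : ℕ) → (Fin (suc m) → Fin n) → Set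
IsCycle G m p = 2 ≤ m × IsPath G m p × Adjacent G (p (fromℕ m)) (p zero)

Connected : ∀ {n} → Graph n → Set
Connected {n} G = ∀ (u v : Fin n) →
  Σ ℕ λ m → Σ (Fin (suc m) → Fin n) λ p → IsPath G m p × p zero ≡ u × p (fromℕ m) ≡ v

Acyclic : ∀ {n} → Graph n → Set
Acyclic {n} G = ∀ (m : ℕ) (p : Fin (suc m) → Fin n) → ¬ IsCycle G m p

IsTree : ∀ {n} → Graph n → Set
IsTree G = Connected G × Acyclic G

-- S is a k-path vertex cover (k = suc m): every path on suc m vertices meets S.
IsPathCover : ∀ {n} → Graph n → (m : ℕ) → Subset n → Set
IsPathCover {n} G m S = ∀ (p : Fin (suc m) → Fin n) → IsPath G m p → ∃ λ i → p i ∈ S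

-- ψ_{suc m}(G) = c : c is the minimum cardinality of a (suc m)-path vertex cover.
IsPsi : ∀ {n} → Graph n → (m : ℕ) → ℕ → Set
IsPsi {n} G m c =
  (Σ (Subset n) λ S → IsPathCover G m S × ∣ S ∣ ≡ c) ×
  (∀ (S : Subset n) → IsPathCover G m S → c ≤ ∣ S ∣)

-- ψ(G₁) = ψ(G₂): for every k = suc m ∈ {1,…,n}, ψ_k(G₁) and ψ_k(G₂) are the same number.
SamePathSequence : ∀ {n} → Graph n → Graph n → Set
SamePathSequence {n} G₁ G₂ =
  ∀ (m : ℕ) → m < n → Σ ℕ λ c → IsPsi G₁ m c × IsPsi G₂ m c

Isomorphic : ∀ {n} → Graph n → Graph n → Set
Isomorphic {n} G₁ G₂ =
  Σ (Fin n ↔ Fin n) λ f → ∀ u v → adj G₁ u v ≡ adj G₂ (Inverse.to f u) (Inverse.to f v)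

module Submission where

-- For n = 7 + k consider the rooted trees of height two with root c, two
-- children A and B of c, one leaf ℓ below B, k + 2 leaves aᵢ below A, and a
-- spare leaf s placed below A (tree T₁) or below B (tree T₂).  Both trees
-- have path sequence (n, 2, 2, 1, 1, 0, …, 0): {A, B} is an optimal cover
-- for paths on 2 and 3 vertices, {c} for paths on 4 and 5 vertices, and
-- there is no path on 6 vertices.  Only T₁ has a leaf hanging from a vertex
-- of degree two (ℓ at B), so T₁ and T₂ are not isomorphic.

open import Defs
open import Data.Nat using (ℕ; zero; suc; _≤_; _<_; z≤n; s≤s; _+_)
open import Data.Nat.Properties using (≤-trans)
open import Data.Bool using (Bool; true; false)
open import Data.Bool.Properties using (∨-comm)
open import Data.Product using (Σ; ∃; _×_; _,_)
open import Data.Sum using (_⊎_; inj₁; inj₂; swap) renaming (map to ⊎-map)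
open import Data.Empty using (⊥; ⊥-elim)
open import Data.Fin using (Fin; zero; suc; inject₁; fromℕ; _≟_)
open import Data.Fin.Properties using (suc-injective; inject₁-injective; 0≢1+n)
open import Data.Fin.Subset using (Subset; _∈_; ∣_∣; ⊤; ⁅_⁆; _⊆_; inside; outside)
  renaming (⊥ to ∅)
open import Data.Fin.Subset.Properties
  using (∣⊤∣≡n; ∣⊥∣≡0; ∣⁅x⁆∣≡1; p⊆q⇒∣p∣≤∣q∣; x∈⁅y⁆⇒x≡y; x∈⁅x⁆; ∈⊤; x∈p∧x≢y⇒x∈p-y; x∈p⇒∣p-x∣<∣p∣)
open import Data.List using (List; []; _∷_; length; lookup; _++_)
open import Data.Vec using (_∷_; here; there)
open import Data.List.Membership.Propositional using () renaming (_∈_ to _∈ₗ_; _∉_ to _∉ₗ_)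
open import Data.List.Membership.Propositional.Properties using (∈-lookup)
import Data.List.Membership.DecPropositional as DecMembership
open import Data.List.Relation.Unary.Any using (here; there)
open import Data.List.Relation.Unary.All as All using (All; []; all?)
open import Data.List.Relation.Unary.All.Properties using (¬Any⇒All¬)
open import Data.List.Relation.Unary.AllPairs using ([]; _∷_)
open import Data.List.Relation.Unary.Linked using (Linked; []; [-]; _∷_; linked?)
open import Data.List.Relation.Unary.Unique.Propositional using (Unique)
import Data.List.Relation.Unary.Unique.DecPropositional as DecUnique
open import Function.Bundles using (Inverse)
open import Function.Definitions using (Injective)
open import Relation.Nullary using (¬_; Dec; yes; no; does)
open import Relation.Nullary.Decidable using (from-yes; dec-true; dec-false; ¬?; _×-dec_; _⊎-dec_)
open import Relation.Binary.PropositionalEquality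
  using (_≡_; _≢_; refl; sym; trans; cong; subst)

adjacent-sym : ∀ {n} (G : Graph n) {u v : Fin n} → Adjacent G u v → Adjacent G v u
adjacent-sym G {u} {v} e = trans (adj-sym G v u) e

adjacent? : ∀ {n} (G : Graph n) (u v : Fin n) → Dec (Adjacent G u v)
adjacent? G u v = adj G u v Data.Bool.≟ true

apart : ∀ {A B : Set} {f : A → B} → Injective _≡_ _≡_ f → ∀ {i j} → i ≢ j → f i ≢ f j
apart inj i≢j e = i≢j (inj e)

path-init : ∀ {n} (G : Graph n) {m : ℕ} {p : Fin (suc (suc m)) → Fin n} →
  IsPath G (suc m) p → IsPath G m (λ i → p (inject₁ i))
path-init G (inj , ad) = (λ e → inject₁-injective (inj e)) , (λ i → ad (inject₁ i))

member⇒1≤∣∣ : ∀ {n} {S : Subset n} {x : Fin n} → x ∈ S → 1 ≤ ∣ S ∣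
member⇒1≤∣∣ {S = S} {x} x∈S =
  subst (_≤ ∣ S ∣) (∣⁅x⁆∣≡1 x) (p⊆q⇒∣p∣≤∣q∣ ⁅x⁆⊆S)
  where
  ⁅x⁆⊆S : ⁅ x ⁆ ⊆ S
  ⁅x⁆⊆S y∈⁅x⁆ = subst (_∈ S) (sym (x∈⁅y⁆⇒x≡y x y∈⁅x⁆)) x∈S

twoMembers⇒2≤∣∣ : ∀ {n} {S : Subset n} {x y : Fin n} → x ∈ S → y ∈ S → x ≢ y → 2 ≤ ∣ S ∣
twoMembers⇒2≤∣∣ x∈S y∈S x≢y =
  ≤-trans (s≤s (member⇒1≤∣∣ (x∈p∧x≢y⇒x∈p-y y∈S (λ y≡x → x≢y (sym y≡x)))))
          (x∈p⇒∣p-x∣<∣p∣ x∈S)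

-- ψ₁(G) = n for every graph: a single vertex is a path on one vertex, so a
-- 1-path vertex cover must contain every vertex.
psi₁ : ∀ {n} (G : Graph n) → IsPsi G 0 n
psi₁ {n} G = (⊤ , (λ _ _ → zero , ∈⊤) , ∣⊤∣≡n n) , coversAll
  where
  onlyPosition : (i j : Fin 1) → i ≡ j
  onlyPosition zero zero = refl
  single : ∀ (x : Fin n) → IsPath G 0 (λ _ → x)
  single x = (λ {i} {j} _ → onlyPosition i j) , λ ()
  coversAll : ∀ S → IsPathCover G 0 S → n ≤ ∣ S ∣
  coversAll S cov = subst (_≤ ∣ S ∣) (∣⊤∣≡n n) (p⊆q⇒∣p∣≤∣q∣ ⊤⊆S)
    where
    ⊤⊆S : ⊤ ⊆ S
    ⊤⊆S {x} _ with cov (λ _ → x) (single x)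
    ... | zero , x∈S = x∈S

noPaths⇒psi0 : ∀ {n} (G : Graph n) (m : ℕ) → (∀ p → ¬ IsPath G m p) → IsPsi G m 0
noPaths⇒psi0 {n} G m noPath =
  (∅ , (λ p isPath → ⊥-elim (noPath p isPath)) , ∣⊥∣≡0 n) , (λ _ _ → z≤n)

path⇒1≤ : ∀ {n} (G : Graph n) {m : ℕ} {p : Fin (suc m) → Fin n} {S : Subset n} →
  IsPath G m p → IsPathCover G m S → 1 ≤ ∣ S ∣
path⇒1≤ G {p = p} path cov with cov p path
... | _ , hit = member⇒1≤∣∣ hit

HasPathSequence : ∀ {n} → Graph n → (ℕ → ℕ) → Set
HasPathSequence {n} G f = ∀ m → m < n → IsPsi G m (f m)

samePathSequence : ∀ {n} (G₁ G₂ : Graph n) (f : ℕ → ℕ) →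
  HasPathSequence G₁ f → HasPathSequence G₂ f → SamePathSequence G₁ G₂
samePathSequence G₁ G₂ f ψG₁ ψG₂ m m<n = f m , ψG₁ m m<n , ψG₂ m m<n

-- Paths as lists: a duplicate-free list whose consecutive entries are
-- adjacent.  For explicit lists this is decidable, so such facts are
-- discharged by computation (from-yes).
PathList : ∀ {n} → Graph n → List (Fin n) → Set
PathList G vs = Unique vs × Linked (Adjacent G) vs

pathList? : ∀ {n} (G : Graph n) (vs : List (Fin n)) → Dec (PathList G vs)
pathList? G vs = DecUnique.unique? _≟_ vs ×-dec linked? (adjacent? G) vs

lookup-injective : ∀ {n} (vs : List (Fin n)) → Unique vs →
  ∀ i j → lookup vs i ≡ lookup vs j → i ≡ j
lookup-injective (v ∷ vs) _ zero zero _ = refl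
lookup-injective (v ∷ vs) (v∉ ∷ _) zero (suc j) e = ⊥-elim (All.lookup v∉ (∈-lookup j) e)
lookup-injective (v ∷ vs) (v∉ ∷ _) (suc i) zero e = ⊥-elim (All.lookup v∉ (∈-lookup i) (sym e))
lookup-injective (v ∷ vs) (_ ∷ u) (suc i) (suc j) e = cong suc (lookup-injective vs u i j e)

lookup-linked : ∀ {n} (G : Graph n) (v : Fin n) (vs : List (Fin n)) →
  Linked (Adjacent G) (v ∷ vs) → ∀ (i : Fin (length vs)) →
  Adjacent G (lookup (v ∷ vs) (inject₁ i)) (lookup (v ∷ vs) (suc i))
lookup-linked G v (w ∷ ws) (vw ∷ _) zero = vw
lookup-linked G v (w ∷ ws) (_ ∷ l) (suc i) = lookup-linked G w ws l i

pathList⇒isPath : ∀ {n} (G : Graph n) (v : Fin n) (vs : List (Fin n)) →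
  PathList G (v ∷ vs) → IsPath G (length vs) (lookup (v ∷ vs))
pathList⇒isPath G v vs (u , l) =
  (λ {i} {j} → lookup-injective (v ∷ vs) u i j) , lookup-linked G v vs l

cover-meets : ∀ {n} (G : Graph n) (v : Fin n) (vs : List (Fin n)) {S : Subset n} →
  PathList G (v ∷ vs) → IsPathCover G (length vs) S → ∃ λ w → w ∈ₗ v ∷ vs × w ∈ S
cover-meets G v vs P cov with cov (lookup (v ∷ vs)) (pathList⇒isPath G v vs P)
... | i , hit = lookup (v ∷ vs) i , ∈-lookup i , hit

Disjoint : ∀ {n} → List (Fin n) → List (Fin n) → Set
Disjoint vs ws = All (_∉ₗ ws) vs

disjoint? : ∀ {n} (vs ws : List (Fin n)) → Dec (Disjoint vs ws)
disjoint? vs ws = all? (λ v → ¬? (DecMembership._∈?_ _≟_ v ws)) vs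

twoPaths⇒2≤ : ∀ {n} (G : Graph n) (v w : Fin n) (vs ws : List (Fin n)) {S : Subset n} →
  PathList G (v ∷ vs) → PathList G (w ∷ ws) → length vs ≡ length ws →
  Disjoint (v ∷ vs) (w ∷ ws) → IsPathCover G (length vs) S → 2 ≤ ∣ S ∣
twoPaths⇒2≤ G v w vs ws {S} P Q sameLength disjoint cov
  with cover-meets G v vs P cov
     | cover-meets G w ws Q (subst (λ m → IsPathCover G m S) sameLength cov)
... | x , x∈P , x∈S | y , y∈Q , y∈S =
  twoMembers⇒2≤∣∣ x∈S y∈S (λ { refl → All.lookup disjoint x∈P y∈Q })

lastOf : ∀ {A : Set} → A → List A → A
lastOf x [] = x
lastOf x (y ∷ ys) = lastOf y ys

Walk : ∀ {n} → Graph n → Fin n → Fin n → Set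
Walk {n} G u v = Σ (List (Fin n)) λ xs → Linked (Adjacent G) (u ∷ xs) × lastOf u xs ≡ v

walk-++ : ∀ {n} (G : Graph n) {u v w : Fin n} → Walk G u v → Walk G v w → Walk G u w
walk-++ G {u} (xs , l , refl) (ys , l′ , end) = xs ++ ys , join u xs l l′ , trans (last-++ u xs) end
  where
  join : ∀ x xs → Linked (Adjacent G) (x ∷ xs) → Linked (Adjacent G) (lastOf x xs ∷ ys) →
         Linked (Adjacent G) (x ∷ xs ++ ys)
  join x [] _ l″ = l″
  join x (y ∷ xs) (xy ∷ l) l″ = xy ∷ join y xs l l″
  last-++ : ∀ x xs → lastOf x (xs ++ ys) ≡ lastOf (lastOf x xs) ys
  last-++ x [] = refl
  last-++ x (y ∷ xs) = last-++ y xs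

reverse-walk : ∀ {n} (G : Graph n) {u v : Fin n} → Walk G u v → Walk G v u
reverse-walk G ([] , _ , refl) = [] , [-] , refl
reverse-walk G {u} (x ∷ xs , ux ∷ l , end) =
  walk-++ G (reverse-walk G (xs , l , end)) (u ∷ [] , adjacent-sym G {u} ux ∷ [-] , refl)

suffixFrom : ∀ {n} (G : Graph n) {x y : Fin n} {ys : List (Fin n)} → x ∈ₗ y ∷ ys →
  PathList G (y ∷ ys) → ∃ λ zs → PathList G (x ∷ zs) × lastOf x zs ≡ lastOf y ys
suffixFrom G {ys = ys} (here refl) P = ys , P , refl
suffixFrom G {ys = _ ∷ _} (there x∈ys) (_ ∷ u , _ ∷ l) = suffixFrom G x∈ys (u , l)

-- Prepending a neighbour x to a path list: if x already occurs, cut the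
-- list back to start at x, otherwise simply extend it.
prepend : ∀ {n} (G : Graph n) (x y : Fin n) (zs : List (Fin n)) → Adjacent G x y →
  PathList G (y ∷ zs) → ∃ λ ws → PathList G (x ∷ ws) × lastOf x ws ≡ lastOf y zs
prepend G x y zs xy (u , l) with DecMembership._∈?_ _≟_ x (y ∷ zs)
... | yes x∈ = suffixFrom G x∈ (u , l)
... | no x∉ = y ∷ zs , (¬Any⇒All¬ (y ∷ zs) x∉ ∷ u , xy ∷ l) , refl

shortcut : ∀ {n} (G : Graph n) (x : Fin n) (xs : List (Fin n)) → Linked (Adjacent G) (x ∷ xs) →
  ∃ λ zs → PathList G (x ∷ zs) × lastOf x zs ≡ lastOf x xs
shortcut G x [] _ = [] , ([] ∷ [] , [-]) , refl
shortcut G x (y ∷ ys) (xy ∷ l) with shortcut G y ys l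
... | zs , P , end with prepend G x y zs xy P
...   | ws , Q , end′ = ws , Q , trans end′ end

lookup-last : ∀ {n} (x : Fin n) (xs : List (Fin n)) → lookup (x ∷ xs) (fromℕ (length xs)) ≡ lastOf x xs
lookup-last x [] = refl
lookup-last x (y ∷ ys) = lookup-last y ys

walk⇒path : ∀ {n} (G : Graph n) {u v : Fin n} → Walk G u v →
  Σ ℕ λ m → Σ (Fin (suc m) → Fin n) λ p → IsPath G m p × p zero ≡ u × p (fromℕ m) ≡ v
walk⇒path G {u} (xs , l , end) with shortcut G u xs l
... | zs , P , end′ =
  length zs , lookup (u ∷ zs) , pathList⇒isPath G u zs P , refl , trans (lookup-last u zs) (trans end′ end)

connected-viaHub : ∀ {n} (G : Graph n) (hub : Fin n) → (∀ u → Walk G u hub) → Connected G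
connected-viaHub G hub toHub u v = walk⇒path G (walk-++ G (toHub u) (reverse-walk G (toHub v)))

-- An isomorphism invariant: a leaf z hanging from a vertex y of degree two
-- (y has exactly the neighbours z and w, and z has only the neighbour y).
HasPendantAtDegreeTwo : ∀ {n} → Graph n → Set
HasPendantAtDegreeTwo {n} G = Σ (Fin n) λ y → Σ (Fin n) λ z → Σ (Fin n) λ w →
  Adjacent G y z × Adjacent G y w × z ≢ w ×
  (∀ u → Adjacent G y u → u ≡ z ⊎ u ≡ w) × (∀ u → Adjacent G z u → u ≡ y)

pendant-transfer : ∀ {n} (G₁ G₂ : Graph n) → Isomorphic G₁ G₂ →
  HasPendantAtDegreeTwo G₁ → HasPendantAtDegreeTwo G₂
pendant-transfer G₁ G₂ (φ , preserves) (y , z , w , yz , yw , z≢w , neighbours-y , neighbours-z) =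
  f y , f z , f w , forth yz , forth yw , (λ e → z≢w (f-injective e)) ,
  (λ u e → ⊎-map (pull u) (pull u) (neighbours-y (g u) (back e))) ,
  (λ u e → pull u (neighbours-z (g u) (back e)))
  where
  f = Inverse.to φ
  g = Inverse.from φ
  f-injective : ∀ {a b} → f a ≡ f b → a ≡ b
  f-injective {a} {b} e =
    trans (sym (Inverse.strictlyInverseʳ φ a)) (trans (cong g e) (Inverse.strictlyInverseʳ φ b))
  forth : ∀ {a b} → Adjacent G₁ a b → Adjacent G₂ (f a) (f b)
  forth {a} {b} e = trans (sym (preserves a b)) e
  back : ∀ {a u} → Adjacent G₂ (f a) u → Adjacent G₁ a (g u)
  back {a} {u} e =
    trans (preserves a (g u)) (subst (Adjacent G₂ (f a)) (sym (Inverse.strictlyInverseˡ φ u)) e)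
  pull : ∀ u {a} → g u ≡ a → u ≡ f a
  pull u e = trans (sym (Inverse.strictlyInverseˡ φ u)) (cong f e)

nonIsomorphic-byPendant : ∀ {n} (G₁ G₂ : Graph n) →
  HasPendantAtDegreeTwo G₁ → ¬ HasPendantAtDegreeTwo G₂ → ¬ Isomorphic G₁ G₂
nonIsomorphic-byPendant G₁ G₂ has hasNot iso = hasNot (pendant-transfer G₁ G₂ iso has)

pigeonhole : ∀ {A : Set} {a b c z w : A} → a ≢ b → a ≢ c → b ≢ c →
  a ≡ z ⊎ a ≡ w → b ≡ z ⊎ b ≡ w → c ≡ z ⊎ c ≡ w → ⊥
pigeonhole a≢b _ _ (inj₁ refl) (inj₁ refl) _ = a≢b refl
pigeonhole a≢b _ _ (inj₂ refl) (inj₂ refl) _ = a≢b refl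
pigeonhole _ a≢c _ (inj₁ refl) (inj₂ refl) (inj₁ refl) = a≢c refl
pigeonhole _ _ b≢c (inj₁ refl) (inj₂ refl) (inj₂ refl) = b≢c refl
pigeonhole _ _ b≢c (inj₂ refl) (inj₁ refl) (inj₁ refl) = b≢c refl
pigeonhole _ a≢c _ (inj₂ refl) (inj₁ refl) (inj₂ refl) = a≢c refl

threeNeighbours⇒¬degreeTwo : ∀ {n} (G : Graph n) {y z w a b c : Fin n} →
  Adjacent G y a → Adjacent G y b → Adjacent G y c → a ≢ b → a ≢ c → b ≢ c →
  ¬ (∀ u → Adjacent G y u → u ≡ z ⊎ u ≡ w)
threeNeighbours⇒¬degreeTwo G ya yb yc a≢b a≢c b≢c onlyTwo =
  pigeonhole a≢b a≢c b≢c (onlyTwo _ ya) (onlyTwo _ yb) (onlyTwo _ yc)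

decided : ∀ {P : Set} (d : Dec P) → does d ≡ true → P
decided (yes p) _ = p
decided (no _) ()

twoArmSequence : ℕ → ℕ → ℕ
twoArmSequence n 0 = n
twoArmSequence n 1 = 2
twoArmSequence n 2 = 2
twoArmSequence n 3 = 1
twoArmSequence n 4 = 1
twoArmSequence n (suc (suc (suc (suc (suc _))))) = 0

-- Rooted trees of height at most two, given by a parent map in which the
-- grandparent of every vertex is the root.  The tree graph joins every
-- non-root vertex to its parent.
record HeightTwoTree (n : ℕ) : Set where
  field
    root             : Fin n
    parent           : Fin n → Fin n
    grandparent-root : ∀ x → parent (parent x) ≡ root

module HeightTwo {n : ℕ} (T : HeightTwoTree n) where
  open HeightTwoTree T

  IsChild : Fin n → Fin n → Set
  IsChild c p = c ≢ root × parent c ≡ p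

  isChild? : ∀ c p → Dec (IsChild c p)
  isChild? c p = ¬? (c ≟ root) ×-dec (parent c ≟ p)

  -- A vertex that is its own parent is its own grandparent, i.e. the root.
  not-own-child : ∀ {x} → ¬ IsChild x x
  not-own-child {x} (x≢root , px≡x) =
    x≢root (trans (sym (trans (cong parent px≡x) px≡x)) (grandparent-root x))

  graph : Graph n
  graph = record
    { adj        = λ u v → does (isChild? u v ⊎-dec isChild? v u)
    ; adj-sym    = λ u v → ∨-comm (does (isChild? u v)) (does (isChild? v u))
    ; adj-irrefl = λ v → dec-false (isChild? v v ⊎-dec isChild? v v)
                                   (λ { (inj₁ c) → not-own-child c ; (inj₂ c) → not-own-child c })
    }

  adjacent⇒child : ∀ {u v} → Adjacent graph u v → IsChild u v ⊎ IsChild v u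
  adjacent⇒child {u} {v} = decided (isChild? u v ⊎-dec isChild? v u)

  child⇒adjacent : ∀ {u v} → IsChild u v → Adjacent graph u v
  child⇒adjacent {u} {v} c = dec-true (isChild? u v ⊎-dec isChild? v u) (inj₁ c)

  -- Inner vertices: the root and its children.  Only these have two
  -- distinct neighbours, and any edge between two of them contains the root.
  record Inner (x : Fin n) : Set where
    constructor inner
    field parent≡root : parent x ≡ root

  outer-neighbour : ∀ {x y} → ¬ Inner x → Adjacent graph x y → y ≡ parent x
  outer-neighbour ¬inner xy with adjacent⇒child xy
  ... | inj₁ (_ , px≡y) = sym px≡y
  ... | inj₂ (_ , py≡x) = ⊥-elim (¬inner (inner (subst (λ t → parent t ≡ root) py≡x (grandparent-root _))))

  twoNeighbours⇒inner : ∀ {x y z} → Adjacent graph x y → Adjacent graph x z → y ≢ z → Inner x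
  twoNeighbours⇒inner {x} xy xz y≢z with parent x ≟ root
  ... | yes px≡root = inner px≡root
  ... | no px≢root = ⊥-elim (y≢z (trans (outer-neighbour ¬inner xy) (sym (outer-neighbour ¬inner xz))))
    where
    ¬inner : ¬ Inner x
    ¬inner (inner px≡root) = px≢root px≡root

  innerEdge : ∀ {x y} → Inner x → Inner y → Adjacent graph x y → x ≡ root ⊎ y ≡ root
  innerEdge (inner ix) (inner iy) xy with adjacent⇒child xy
  ... | inj₁ (_ , px≡y) = inj₂ (trans (sym px≡y) ix)
  ... | inj₂ (_ , py≡x) = inj₁ (trans (sym py≡x) iy)

  -- A common neighbour b of two distinct inner vertices a, c is the root:
  -- b is inner itself, and the root lies on both edges ab and bc.
  middle⇒root : ∀ {a b c} → Inner a → Inner c → Adjacent graph a b → Adjacent graph b c → a ≢ c → b ≡ root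
  middle⇒root {a} {b} {c} ia ic ab bc a≢c = onBoth (innerEdge {a} {b} ia ib ab) (innerEdge {b} {c} ib ic bc)
    where
    ib : Inner b
    ib = twoNeighbours⇒inner {b} {a} {c} (adjacent-sym graph {a} {b} ab) bc a≢c
    onBoth : a ≡ root ⊎ b ≡ root → b ≡ root ⊎ c ≡ root → b ≡ root
    onBoth (inj₂ b≡root) _ = b≡root
    onBoth (inj₁ _) (inj₁ b≡root) = b≡root
    onBoth (inj₁ a≡root) (inj₂ c≡root) = ⊥-elim (a≢c (trans a≡root (sym c≡root)))

  interior-inner : ∀ {m} {p : Fin (suc (suc m)) → Fin n} → IsPath graph (suc m) p →
    ∀ (i : Fin m) → Inner (p (suc (inject₁ i)))
  interior-inner {p = p} (inj , ad) i =
    twoNeighbours⇒inner {p (suc (inject₁ i))} {p (inject₁ (inject₁ i))} {p (suc (suc i))}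
      (adjacent-sym graph {p (inject₁ (inject₁ i))} (ad (inject₁ i))) (ad (suc i)) (apart inj (before i))
    where
    before : ∀ {m} (i : Fin m) → inject₁ (inject₁ i) ≢ suc (suc i)
    before zero ()
    before (suc i) e = before i (suc-injective e)

  -- A cycle p₀ … pₘ (m ≥ 2) would have two roots: p₀ lies between the inner
  -- vertices pₘ and p₁, and pₘ lies between the inner vertices pₘ₋₁ and p₀.
  acyclic : Acyclic graph
  acyclic (suc zero) p (s≤s () , _)
  acyclic (suc (suc k)) p (_ , path@(inj , ad) , closing) =
    apart inj (λ ()) (trans pₘ≡root (sym p₀≡root))
    where
    pₘ₋₁≢p₀ : p (inject₁ (fromℕ (suc k))) ≢ p zero
    pₘ₋₁≢p₀ = apart inj (λ ())
    p₁≢pₘ : p (suc zero) ≢ p (fromℕ (suc (suc k)))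
    p₁≢pₘ = apart inj (λ ())
    inner₀ : Inner (p zero)
    inner₀ = twoNeighbours⇒inner {p zero} {p (suc zero)} {p (fromℕ (suc (suc k)))}
               (ad zero) (adjacent-sym graph {p (fromℕ (suc (suc k)))} closing) p₁≢pₘ
    innerₘ : Inner (p (fromℕ (suc (suc k))))
    innerₘ = twoNeighbours⇒inner {p (fromℕ (suc (suc k)))} {p (inject₁ (fromℕ (suc k)))} {p zero}
               (adjacent-sym graph {p (inject₁ (fromℕ (suc k)))} (ad (fromℕ (suc k)))) closing pₘ₋₁≢p₀
    p₀≡root : p zero ≡ root
    p₀≡root = middle⇒root innerₘ (interior-inner path zero) closing (ad zero) (λ e → p₁≢pₘ (sym e))
    pₘ≡root : p (fromℕ (suc (suc k))) ≡ root
    pₘ≡root = middle⇒root (interior-inner path (fromℕ k)) inner₀ (ad (fromℕ (suc k))) closing pₘ₋₁≢p₀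

  -- No path has six vertices: its third and fourth vertices would both be
  -- the root, each lying between two interior (hence inner) vertices.
  noLongPaths : ∀ k (p : Fin (6 + k) → Fin n) → ¬ IsPath graph (5 + k) p
  noLongPaths k p path@(inj , ad) = apart inj 2≢3 (trans p₂≡root (sym p₃≡root))
    where
    interior : ∀ (i : Fin (4 + k)) → Inner (p (suc (inject₁ i)))
    interior = interior-inner path
    2≢3 : _≢_ {A = Fin (6 + k)} (suc (suc zero)) (suc (suc (suc zero)))
    2≢3 ()
    p₂≡root : p (suc (suc zero)) ≡ root
    p₂≡root = middle⇒root (interior zero) (interior (suc (suc zero)))
                (ad (suc zero)) (ad (suc (suc zero))) (apart inj (λ ()))
    p₃≡root : p (suc (suc (suc zero))) ≡ root
    p₃≡root = middle⇒root (interior (suc zero)) (interior (suc (suc (suc zero))))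
                (ad (suc (suc zero))) (ad (suc (suc (suc zero)))) (apart inj (λ ()))

  -- {root} meets every path on at least four vertices: its second and third
  -- vertices are adjacent inner vertices, so one of them is the root.
  rootCover : ∀ k → IsPathCover graph (3 + k) ⁅ root ⁆
  rootCover k p path@(_ , ad)
    with innerEdge (interior-inner path zero) (interior-inner path (suc zero)) (ad (suc zero))
  ... | inj₁ p₁≡root = suc zero , subst (_∈ ⁅ root ⁆) (sym p₁≡root) (x∈⁅x⁆ root)
  ... | inj₂ p₂≡root = suc (suc zero) , subst (_∈ ⁅ root ⁆) (sym p₂≡root) (x∈⁅x⁆ root)

  child-meetsChildren : ∀ {c p} → IsChild c p → IsChild c root ⊎ IsChild p root
  child-meetsChildren {c} {p} (c≢root , pc≡p) with p ≟ root
  ... | yes p≡root = inj₁ (c≢root , trans pc≡p p≡root)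
  ... | no p≢root = inj₂ (p≢root , trans (cong parent (sym pc≡p)) (grandparent-root c))

  edge-meetsChildren : ∀ {u v} → Adjacent graph u v → IsChild u root ⊎ IsChild v root
  edge-meetsChildren uv with adjacent⇒child uv
  ... | inj₁ u-child = child-meetsChildren u-child
  ... | inj₂ v-child = swap (child-meetsChildren v-child)

  -- The children of the root cover the paths on two and on three vertices:
  -- the middle vertex of a 3-path is the root or a child of it, and in the
  -- first case the first vertex is a child of the root.
  ContainsChildren : Subset n → Set
  ContainsChildren S = ∀ x → IsChild x root → x ∈ S

  childrenCover₂ : ∀ {S} → ContainsChildren S → IsPathCover graph 1 S
  childrenCover₂ children p (_ , ad) with edge-meetsChildren (ad zero)
  ... | inj₁ p₀-child = zero , children _ p₀-child
  ... | inj₂ p₁-child = suc zero , children _ p₁-child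

  childrenCover₃ : ∀ {S} → ContainsChildren S → IsPathCover graph 2 S
  childrenCover₃ children p path@(_ , ad) with p (suc zero) ≟ root
  ... | no p₁≢root = suc zero , children _ (p₁≢root , Inner.parent≡root (interior-inner path zero))
  ... | yes p₁≡root with edge-meetsChildren (ad zero)
  ...   | inj₁ p₀-child = zero , children _ p₀-child
  ...   | inj₂ (p₁≢root , _) = ⊥-elim (p₁≢root p₁≡root)

  walkToRoot : ∀ u → Walk graph u root
  walkToRoot u with u ≟ root
  ... | yes u≡root = [] , [-] , u≡root
  ... | no u≢root with parent u ≟ root
  ...   | yes pu≡root = root ∷ [] , child⇒adjacent (u≢root , pu≡root) ∷ [-] , refl
  ...   | no pu≢root =
    parent u ∷ root ∷ [] ,
    child⇒adjacent (u≢root , refl) ∷ child⇒adjacent (pu≢root , grandparent-root u) ∷ [-] , refl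

  isTree : IsTree graph
  isTree = connected-viaHub graph root walkToRoot , acyclic

  pathSequence : ∀ (S : Subset n) → ContainsChildren S → ∣ S ∣ ≡ 2 →
    (∀ S′ → IsPathCover graph 1 S′ → 2 ≤ ∣ S′ ∣) →
    (∀ S′ → IsPathCover graph 2 S′ → 2 ≤ ∣ S′ ∣) →
    (Σ (Fin 5 → Fin n) λ p → IsPath graph 4 p) →
    HasPathSequence graph (twoArmSequence n)
  pathSequence S children ∣S∣≡2 ψ₂≥2 ψ₃≥2 (p , path₅) = ψ
    where
    ψ : HasPathSequence graph (twoArmSequence n)
    ψ 0 _ = psi₁ graph
    ψ 1 _ = (S , childrenCover₂ children , ∣S∣≡2) , ψ₂≥2
    ψ 2 _ = (S , childrenCover₃ children , ∣S∣≡2) , ψ₃≥2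
    ψ 3 _ = (⁅ root ⁆ , rootCover 0 , ∣⁅x⁆∣≡1 root) , (λ _ → path⇒1≤ graph (path-init graph path₅))
    ψ 4 _ = (⁅ root ⁆ , rootCover 1 , ∣⁅x⁆∣≡1 root) , (λ _ → path⇒1≤ graph path₅)
    ψ (suc (suc (suc (suc (suc k))))) _ = noPaths⇒psi0 graph (5 + k) (noLongPaths k)
module TwoArmTrees (k : ℕ) where

  pattern centre  = zero
  pattern armA    = suc zero
  pattern armB    = suc (suc zero)
  pattern leafB   = suc (suc (suc zero))
  pattern spare   = suc (suc (suc (suc zero)))
  pattern leafA i = suc (suc (suc (suc (suc i))))

  -- spareAtB = false gives the first tree, true the second.
  spareParent : (spareAtB : Bool) → Fin (7 + k)
  spareParent false = armA
  spareParent true  = armB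

  parent : (spareAtB : Bool) → Fin (7 + k) → Fin (7 + k)
  parent _ centre    = centre
  parent _ armA      = centre
  parent _ armB      = centre
  parent _ leafB     = armB
  parent b spare     = spareParent b
  parent _ (leafA _) = armA

  grandparent : ∀ spareAtB x → parent spareAtB (parent spareAtB x) ≡ centre
  grandparent _     centre    = refl
  grandparent _     armA      = refl
  grandparent _     armB      = refl
  grandparent _     leafB     = refl
  grandparent false spare     = refl
  grandparent true  spare     = refl
  grandparent _     (leafA _) = refl

  tree : Bool → HeightTwoTree (7 + k)
  tree spareAtB = record
    { root = centre ; parent = parent spareAtB ; grandparent-root = grandparent spareAtB }

  open module Tree (spareAtB : Bool) = HeightTwo (tree spareAtB)
    using (graph; IsChild; ContainsChildren; adjacent⇒child; twoNeighbours⇒inner; isTree; pathSequence)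
    public

  arms : Subset (7 + k)
  arms = outside ∷ inside ∷ inside ∷ ∅

  ∣arms∣ : ∣ arms ∣ ≡ 2
  ∣arms∣ = cong (λ c → suc (suc c)) (∣⊥∣≡0 (4 + k))

  rootChild⇒arm : ∀ b {x} → IsChild b x centre → x ≡ armA ⊎ x ≡ armB
  rootChild⇒arm _ {centre} (x≢root , _) = ⊥-elim (x≢root refl)
  rootChild⇒arm _ {armA} _ = inj₁ refl
  rootChild⇒arm _ {armB} _ = inj₂ refl
  rootChild⇒arm _ {leafB} (_ , ())
  rootChild⇒arm false {spare} (_ , ())
  rootChild⇒arm true {spare} (_ , ())
  rootChild⇒arm _ {leafA _} (_ , ())

  arms-containsChildren : ∀ b → ContainsChildren b arms
  arms-containsChildren b x child with rootChild⇒arm b child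
  ... | inj₁ refl = there here
  ... | inj₂ refl = there (there here)

  -- Lower bounds, witnessed by explicit paths avoiding the spare leaf (so
  -- they exist in both trees): the disjoint edges A a₀ and B ℓ, the disjoint
  -- 3-paths a₀ A a₁ and ℓ B centre, and the 5-path a₀ A centre B ℓ.
  ψ₂≥2 : ∀ b S → IsPathCover (graph b) 1 S → 2 ≤ ∣ S ∣
  ψ₂≥2 b _ = twoPaths⇒2≤ (graph b) armA armB (leafA zero ∷ []) (leafB ∷ [])
    (from-yes (pathList? (graph b) (armA ∷ leafA zero ∷ [])))
    (from-yes (pathList? (graph b) (armB ∷ leafB ∷ [])))
    refl (from-yes (disjoint? (armA ∷ leafA zero ∷ []) (armB ∷ leafB ∷ [])))

  ψ₃≥2 : ∀ b S → IsPathCover (graph b) 2 S → 2 ≤ ∣ S ∣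
  ψ₃≥2 b _ = twoPaths⇒2≤ (graph b) (leafA zero) leafB (armA ∷ leafA (suc zero) ∷ []) (armB ∷ centre ∷ [])
    (from-yes (pathList? (graph b) (leafA zero ∷ armA ∷ leafA (suc zero) ∷ [])))
    (from-yes (pathList? (graph b) (leafB ∷ armB ∷ centre ∷ [])))
    refl (from-yes (disjoint? (leafA zero ∷ armA ∷ leafA (suc zero) ∷ []) (leafB ∷ armB ∷ centre ∷ [])))

  path₅ : ∀ b → Σ (Fin 5 → Fin (7 + k)) λ p → IsPath (graph b) 4 p
  path₅ b = _ , pathList⇒isPath (graph b) (leafA zero) (armA ∷ centre ∷ armB ∷ leafB ∷ [])
    (from-yes (pathList? (graph b) (leafA zero ∷ armA ∷ centre ∷ armB ∷ leafB ∷ [])))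

  twoArmPathSequence : ∀ b → HasPathSequence (graph b) (twoArmSequence (7 + k))
  twoArmPathSequence b = pathSequence b arms (arms-containsChildren b) ∣arms∣ (ψ₂≥2 b) (ψ₃≥2 b) (path₅ b)

  pendant₁ : HasPendantAtDegreeTwo (graph false)
  pendant₁ = armB , leafB , centre , refl , refl , (λ ()) , neighbours-B , neighbours-ℓ
    where
    onlyChildOfB : ∀ u → parent false u ≡ armB → u ≡ leafB
    onlyChildOfB leafB _ = refl
    onlyChildOfB centre ()
    onlyChildOfB armA ()
    onlyChildOfB armB ()
    onlyChildOfB spare ()
    onlyChildOfB (leafA _) ()
    noChildOfℓ : ∀ u → parent false u ≢ leafB
    noChildOfℓ centre ()
    noChildOfℓ armA ()
    noChildOfℓ armB ()
    noChildOfℓ leafB ()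
    noChildOfℓ spare ()
    noChildOfℓ (leafA _) ()
    neighbours-B : ∀ u → Adjacent (graph false) armB u → u ≡ leafB ⊎ u ≡ centre
    neighbours-B u e with adjacent⇒child false e
    ... | inj₁ (_ , centre≡u) = inj₂ (sym centre≡u)
    ... | inj₂ (_ , pu≡B) = inj₁ (onlyChildOfB u pu≡B)
    neighbours-ℓ : ∀ u → Adjacent (graph false) leafB u → u ≡ armB
    neighbours-ℓ u e with adjacent⇒child false e
    ... | inj₁ (_ , B≡u) = sym B≡u
    ... | inj₂ (_ , pu≡ℓ) = ⊥-elim (noChildOfℓ u pu≡ℓ)

  innerVertex : ∀ b {y} → parent b y ≡ centre → y ≡ centre ⊎ y ≡ armA ⊎ y ≡ armB
  innerVertex _ {centre} _ = inj₁ refl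
  innerVertex _ {armA} _ = inj₂ (inj₁ refl)
  innerVertex _ {armB} _ = inj₂ (inj₂ refl)
  innerVertex _ {leafB} ()
  innerVertex false {spare} ()
  innerVertex true {spare} ()
  innerVertex _ {leafA _} ()

  centreNeighbour-notLeaf : ∀ b {z} → Adjacent (graph b) centre z →
    ¬ (∀ u → Adjacent (graph b) z u → u ≡ centre)
  centreNeighbour-notLeaf b {z} cz onlyCentre with adjacent⇒child b {centre} {z} cz
  ... | inj₁ (centre≢centre , _) = centre≢centre refl
  ... | inj₂ z-child with rootChild⇒arm b z-child
  ...   | inj₁ refl = 0≢1+n (sym (onlyCentre (leafA zero) refl))
  ...   | inj₂ refl = 0≢1+n (sym (onlyCentre leafB refl))

  -- The second tree has no pendant leaf at a vertex of degree two: such a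
  -- vertex is inner, but A and B have three neighbours each in this tree.
  noPendant₂ : ¬ HasPendantAtDegreeTwo (graph true)
  noPendant₂ (y , z , w , yz , yw , z≢w , neighbours-y , neighbours-z)
    with innerVertex true {y} (HeightTwo.Inner.parent≡root (twoNeighbours⇒inner true {y} {z} {w} yz yw z≢w))
  ... | inj₁ refl = centreNeighbour-notLeaf true yz neighbours-z
  ... | inj₂ (inj₁ refl) =
    threeNeighbours⇒¬degreeTwo (graph true) {armA} {z} {w} {centre} {leafA zero} {leafA (suc zero)}
      refl refl refl (λ ()) (λ ()) (λ ()) neighbours-y
  ... | inj₂ (inj₂ refl) =
    threeNeighbours⇒¬degreeTwo (graph true) {armB} {z} {w} {centre} {leafB} {spare}
      refl refl refl (λ ()) (λ ()) (λ ()) neighbours-y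

mainTheorem8 : ∀ (n : ℕ) → 7 ≤ n →
    Σ (Graph n) λ T₁ → Σ (Graph n) λ T₂ →
      IsTree T₁ × IsTree T₂ × SamePathSequence T₁ T₂ × ¬ Isomorphic T₁ T₂
mainTheorem8 _ (s≤s (s≤s (s≤s (s≤s (s≤s (s≤s (s≤s {n = k} z≤n))))))) =
  T₁ , T₂ , isTree false , isTree true ,
  samePathSequence T₁ T₂ (twoArmSequence (7 + k)) (twoArmPathSequence false) (twoArmPathSequence true) ,
  nonIsomorphic-byPendant T₁ T₂ pendant₁ noPendant₂
  where
  open TwoArmTrees k
  T₁ T₂ : Graph (7 + k)
  T₁ = graph false
  T₂ = graph true
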